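{- Every descendant chain $U$ is centrally symmetric. Specifically, realise $U$ as a chain of literal polylines. Then there is a point $O$ such that the point reflection in $O$ maps the oriented polyline $U_i$ onto the oriented polyline $U_{i+4}$ for every $i$; that is, it maps $U$ onto its $4$-th cyclic shift $U_5:U_6:U_7:U_8:U_1:U_2:U_3:U_4$.
   Context: Words are over $\{\mathsf{R},\mathsf{L},\mathsf{U},\mathsf{D}\}$ with reversal $\mathsf{R}\leftrightarrow\mathsf{L}$, $\mathsf{U}\leftrightarrow\mathsf{D}$, and $(w_1\cdots w_k)^{ -1}=w_k^{ -1}\cdots w_1^{ -1}$. Chains $U_1:\cdots:U_8$ have indices modulo $8$. Lifts, for $V=\varphi(U)$: - $f_i$, for $i=1,\dots,4$: $V_j=U_j$ for $j\not\equiv i\pmod 4$, and $V_j=(U_{j+3}U_{j+4}U_{j+5})^{ -1}$ for $j\equiv i\pmod 4$. - $g^\star_{\mathrm{odd}}$: $V_i=(U_{i-2}\cdots U_{i+2})^{ -1}$ for odd $i$, and $V_i=U_{i+3}U_{i+4}U_{i+5}$ for even $i$. - $g^\star_{\mathrm{even}}$: "odd" and "even" swapped. A descendant chain is obtained from the Greek cross $\mathsf{R}:\mathsf{U}\mathsf{R}:\mathsf{U}:\mathsf{L}\mathsf{U}:\mathsf{L}:\mathsf{D}\mathsf{L}:\mathsf{D}:\mathsf{R}\mathsf{D}$ by a finite sequence of these maps. It is realised as literal polylines by evaluating letters as unit segments (right, left, up, down) starting from some point: the parts $U_1,\dots,U_8$ are consecutive pieces of the closed polyline $U_1\cdots U_8$.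 -}

module Defs where

open import Data.Nat using (ℕ; zero; suc; _≡ᵇ_) renaming (_+_ to _+ℕ_)
open import Data.Nat.DivMod using (_mod_; _%_)
open import Data.Fin using (Fin; toℕ)
open import Data.Bool using (Bool; if_then_else_)
open import Data.List using (List; []; _∷_; _++_; reverse; map)
open import Data.Integer using (ℤ; +_; _-_) renaming (_+_ to _+ℤ_)
open import Data.Product using (_×_; _,_)

data Letter : Set where
  R L U D : Letter

Word : Set
Word = List Letter

invL : Letter → Letter
invL R = L
invL L = R
invL U = D
invL D = U

inv : Word → Word
inv w = reverse (map invL w)

-- A chain U₁:⋯:U₈.  Internally stored 0-based: the chain U is a function
-- Fin 8 → Word with U k = U_{k+1}.
Chain : Set
Chain = Fin 8 → Word

-- 1-based access with index taken modulo 8:  get W n = U_n  (U_0 = U_8 etc.)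
get : Chain → ℕ → Word
get W n = W ((n +ℕ 7) mod 8)

-- build a chain from a 1-based description  n ↦ V_n  (n = 1,…,8)
mk : (ℕ → Word) → Chain
mk h k = h (toℕ k +ℕ 1)

-- f_i, i = 1,…,4 (given as i : Fin 4 standing for toℕ i + 1)
f : Fin 4 → Chain → Chain
f i W = mk λ j →
  if (j % 4) ≡ᵇ ((toℕ i +ℕ 1) % 4)
  then inv (get W (j +ℕ 3) ++ get W (j +ℕ 4) ++ get W (j +ℕ 5))
  else get W j

-- (U_{i-2} ⋯ U_{i+2})⁻¹, indices mod 8 (i-2 ≡ i+6, …)
five : Chain → ℕ → Word
five W i = inv (get W (i +ℕ 6) ++ get W (i +ℕ 7) ++ get W (i +ℕ 8)
                ++ get W (i +ℕ 9) ++ get W (i +ℕ 10))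

three : Chain → ℕ → Word
three W i = get W (i +ℕ 3) ++ get W (i +ℕ 4) ++ get W (i +ℕ 5)

isOdd : ℕ → Bool
isOdd n = (n % 2) ≡ᵇ 1

gOdd : Chain → Chain
gOdd W = mk λ i → if isOdd i then five W i else three W i

gEven : Chain → Chain
gEven W = mk λ i → if isOdd i then three W i else five W i

data Move : Set where
  fM    : Fin 4 → Move
  gOddM gEvenM : Move

apply : Move → Chain → Chain
apply (fM i) = f i
apply gOddM  = gOdd
apply gEvenM = gEven

greekCross : Chain
greekCross = mk gc
  where
  gc : ℕ → Word
  gc 1 = R ∷ []
  gc 2 = U ∷ R ∷ []
  gc 3 = U ∷ []
  gc 4 = L ∷ U ∷ []
  gc 5 = L ∷ []
  gc 6 = D ∷ L ∷ []
  gc 7 = D ∷ []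
  gc 8 = R ∷ D ∷ []
  gc _ = []

data Descendant : Chain → Set where
  base : Descendant greekCross
  step : ∀ {V} (m : Move) → Descendant V → Descendant (apply m V)

Point : Set
Point = ℤ × ℤ

move : Letter → Point → Point
move R (x , y) = (x +ℤ + 1 , y)
move L (x , y) = (x - + 1 , y)
move U (x , y) = (x , y +ℤ + 1)
move D (x , y) = (x , y - + 1)

endpt : Point → Word → Point
endpt p []      = p
endpt p (a ∷ w) = endpt (move a p) w

-- the oriented polyline of a word started at p, as its vertex sequence
walk : Point → Word → List Point
walk p []      = p ∷ []
walk p (a ∷ w) = p ∷ walk (move a p) w

-- starting point of the piece U_{n+1} in the polyline U₁⋯U₈ started at p
pos : Chain → Point → ℕ → Point
pos V p zero    = p
pos V p (suc n) = endpt (pos V p n) (get V (suc n))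

-- the piece U_{k+1} (k : Fin 8) of the realisation of V from p
piece : Chain → Point → Fin 8 → List Point
piece V p k = walk (pos V p (toℕ k)) (V k)

shift4 : Fin 8 → Fin 8
shift4 k = (toℕ k +ℕ 4) mod 8

-- point reflection in the centre O, where C = 2·O  (p ↦ 2O − p)
reflect : Point → Point → Point
reflect (cx , cy) (x , y) = (cx - x , cy - y)

{-# OPTIONS --safe #-}
module Submission where

-- Reflecting a lattice walk in a point reverses every step, so the image of the polyline of a
-- word w is the polyline of the letterwise reversal of w. Call a chain antipodal if each
-- U_{i+4} is the letterwise reversal of U_i. The Greek cross is antipodal, and every lift
-- preserves antipodality: the word a lift puts in position i + 4 is given by the same formula
-- in U_{i+4+c} as the word in position i is in U_{i+c}, the choice of formula depends on i
-- only modulo 4, and letterwise reversal commutes with concatenation and with (-)⁻¹. For an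
-- antipodal chain, let O be the midpoint of the start points of U_1 and U_5; walking along the
-- polyline shows that the reflection in O exchanges the start points of U_i and U_{i+4}, and
-- hence maps the piece U_i onto U_{i+4}.

open import Defs
open import Data.Bool using (Bool; true; false; if_then_else_)
open import Data.Fin using (Fin; toℕ)
open import Data.Fin.Patterns using (0F; 1F; 2F; 3F; 4F; 5F; 6F; 7F)
open import Data.Fin.Properties using (toℕ-injective; toℕ-fromℕ<)
open import Data.Integer using (+_; _-_) renaming (_+_ to _+ℤ_)
open import Data.Integer.Tactic.RingSolver using (solve-∀)
open import Data.List using ([]; _∷_; _++_; map)
open import Data.List.Properties using (map-++; map-∘; map-cong; map-id; reverse-map)
open import Data.Nat using (ℕ; zero; suc; _+_; _%_; _≡ᵇ_)
open import Data.Nat.Properties using (+-comm)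
open import Data.Nat.Divisibility using (divides)
open import Data.Nat.DivMod using (_mod_; m%n<n; %-distribˡ-+; %-remove-+ˡ)
open import Data.Product using (Σ; _,_)
open import Relation.Binary.PropositionalEquality
  using (_≡_; refl; sym; trans; cong; cong₂; module ≡-Reasoning)
open ≡-Reasoning

opposite : Word → Word
opposite = map invL

invL-involutive : ∀ a → invL (invL a) ≡ a
invL-involutive R = refl
invL-involutive L = refl
invL-involutive U = refl
invL-involutive D = refl

opposite-involutive : ∀ w → opposite (opposite w) ≡ w
opposite-involutive w = trans (sym (map-∘ w)) (trans (map-cong invL-involutive w) (map-id w))

opposite-swap : ∀ {v w} → v ≡ opposite w → w ≡ opposite v
opposite-swap {w = w} refl = sym (opposite-involutive w)

opposite-inv : ∀ w → opposite (inv w) ≡ inv (opposite w)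
opposite-inv w = reverse-map invL (opposite w)

Antipodal : Chain → Set
Antipodal W = ∀ k → W (shift4 k) ≡ opposite (W k)

Antiperiodic : (ℕ → Word) → Set
Antiperiodic h = ∀ j → h (4 + j) ≡ opposite (h j)

antiperiodic-+ : ∀ {h} → Antiperiodic h → ∀ c → Antiperiodic (λ j → h (j + c))
antiperiodic-+ H c j = H (j + c)

antiperiodic-++ : ∀ {g h} → Antiperiodic g → Antiperiodic h →
  Antiperiodic (λ j → g j ++ h j)
antiperiodic-++ {g} {h} G H j = begin
  g (4 + j) ++ h (4 + j)           ≡⟨ cong₂ _++_ (G j) (H j) ⟩
  opposite (g j) ++ opposite (h j) ≡⟨ map-++ invL (g j) (h j) ⟨
  opposite (g j ++ h j)            ∎

antiperiodic-inv : ∀ {h} → Antiperiodic h → Antiperiodic (λ j → inv (h j))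
antiperiodic-inv {h} H j = trans (cong inv (H j)) (sym (opposite-inv (h j)))

antiperiodic-if : ∀ (b : ℕ → Bool) {g h} → (∀ j → b (4 + j) ≡ b j) →
  Antiperiodic g → Antiperiodic h → Antiperiodic (λ j → if b j then g j else h j)
antiperiodic-if b b-periodic G H j rewrite b-periodic j with b j
... | true  = G j
... | false = H j

shift4-mod : ∀ m → shift4 (m mod 8) ≡ (4 + m) mod 8
shift4-mod m = toℕ-injective (begin
  toℕ (shift4 (m mod 8))  ≡⟨ toℕ-fromℕ< (m%n<n (toℕ (m mod 8) + 4) 8) ⟩
  (toℕ (m mod 8) + 4) % 8 ≡⟨ cong (λ r → (r + 4) % 8) (toℕ-fromℕ< (m%n<n m 8)) ⟩
  (m % 8 + 4) % 8         ≡⟨ %-distribˡ-+ m 4 8 ⟨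
  (m + 4) % 8             ≡⟨ cong (_% 8) (+-comm m 4) ⟩
  (4 + m) % 8             ≡⟨ toℕ-fromℕ< (m%n<n (4 + m) 8) ⟨
  toℕ ((4 + m) mod 8)     ∎)

get-antiperiodic : ∀ {W} → Antipodal W → Antiperiodic (get W)
get-antiperiodic {W} A n = trans (cong W (sym (shift4-mod (n + 7)))) (A ((n + 7) mod 8))

mk-antipodal : ∀ {h} → Antiperiodic h → Antipodal (mk h)
mk-antipodal H 0F = H 1
mk-antipodal H 1F = H 2
mk-antipodal H 2F = H 3
mk-antipodal H 3F = H 4
mk-antipodal H 4F = opposite-swap (H 1)
mk-antipodal H 5F = opposite-swap (H 2)
mk-antipodal H 6F = opposite-swap (H 3)
mk-antipodal H 7F = opposite-swap (H 4)

three-antiperiodic : ∀ {W} → Antiperiodic (get W) → Antiperiodic (three W)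
three-antiperiodic G =
  antiperiodic-++ (antiperiodic-+ G 3) (antiperiodic-++ (antiperiodic-+ G 4) (antiperiodic-+ G 5))

five-antiperiodic : ∀ {W} → Antiperiodic (get W) → Antiperiodic (five W)
five-antiperiodic G = antiperiodic-inv
  (antiperiodic-++ (antiperiodic-+ G 6) (antiperiodic-++ (antiperiodic-+ G 7)
    (antiperiodic-++ (antiperiodic-+ G 8)
      (antiperiodic-++ (antiperiodic-+ G 9) (antiperiodic-+ G 10)))))

isOdd-4+ : ∀ j → isOdd (4 + j) ≡ isOdd j
isOdd-4+ j = cong (_≡ᵇ 1) (%-remove-+ˡ {4} j (divides 2 refl))

f-antipodal : ∀ i {W} → Antipodal W → Antipodal (f i W)
f-antipodal i {W} A = mk-antipodal (antiperiodic-if (λ j → j % 4 ≡ᵇ (toℕ i + 1) % 4)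
  (λ j → cong (_≡ᵇ (toℕ i + 1) % 4) (%-remove-+ˡ {4} j (divides 1 refl)))
  (antiperiodic-inv (three-antiperiodic {W} (get-antiperiodic A))) (get-antiperiodic A))

gOdd-antipodal : ∀ {W} → Antipodal W → Antipodal (gOdd W)
gOdd-antipodal {W} A = mk-antipodal (antiperiodic-if isOdd isOdd-4+
  (five-antiperiodic {W} (get-antiperiodic A)) (three-antiperiodic {W} (get-antiperiodic A)))

gEven-antipodal : ∀ {W} → Antipodal W → Antipodal (gEven W)
gEven-antipodal {W} A = mk-antipodal (antiperiodic-if isOdd isOdd-4+
  (three-antiperiodic {W} (get-antiperiodic A)) (five-antiperiodic {W} (get-antiperiodic A)))

apply-antipodal : ∀ m {W} → Antipodal W → Antipodal (apply m W)
apply-antipodal (fM i) = f-antipodal i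
apply-antipodal gOddM  = gOdd-antipodal
apply-antipodal gEvenM = gEven-antipodal

greekCross-antipodal : Antipodal greekCross
greekCross-antipodal 0F = refl
greekCross-antipodal 1F = refl
greekCross-antipodal 2F = refl
greekCross-antipodal 3F = refl
greekCross-antipodal 4F = refl
greekCross-antipodal 5F = refl
greekCross-antipodal 6F = refl
greekCross-antipodal 7F = refl

descendant-antipodal : ∀ {V} → Descendant V → Antipodal V
descendant-antipodal base       = greekCross-antipodal
descendant-antipodal (step m d) = apply-antipodal m (descendant-antipodal d)

m-[n+1]≡[m-n]-1 : ∀ m n → m - (n +ℤ + 1) ≡ (m - n) - + 1
m-[n+1]≡[m-n]-1 = solve-∀

m-[n-1]≡[m-n]+1 : ∀ m n → m - (n - + 1) ≡ (m - n) +ℤ + 1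
m-[n-1]≡[m-n]+1 = solve-∀

[m+n]-m≡n : ∀ m n → (m +ℤ n) - m ≡ n
[m+n]-m≡n = solve-∀

m-[m-n]≡n : ∀ m n → m - (m - n) ≡ n
m-[m-n]≡n = solve-∀

_⊕_ : Point → Point → Point
(x , y) ⊕ (x′ , y′) = (x +ℤ x′ , y +ℤ y′)

reflect-⊕ : ∀ p q → reflect (p ⊕ q) p ≡ q
reflect-⊕ (x , y) (x′ , y′) = cong₂ _,_ ([m+n]-m≡n x x′) ([m+n]-m≡n y y′)

reflect-involutive : ∀ C p → reflect C (reflect C p) ≡ p
reflect-involutive (c , d) (x , y) = cong₂ _,_ (m-[m-n]≡n c x) (m-[m-n]≡n d y)

reflect-move : ∀ C a p → reflect C (move a p) ≡ move (invL a) (reflect C p)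
reflect-move (c , d) R (x , y) = cong (_, d - y) (m-[n+1]≡[m-n]-1 c x)
reflect-move (c , d) L (x , y) = cong (_, d - y) (m-[n-1]≡[m-n]+1 c x)
reflect-move (c , d) U (x , y) = cong (c - x ,_) (m-[n+1]≡[m-n]-1 d y)
reflect-move (c , d) D (x , y) = cong (c - x ,_) (m-[n-1]≡[m-n]+1 d y)

reflect-walk : ∀ C p w → map (reflect C) (walk p w) ≡ walk (reflect C p) (opposite w)
reflect-walk C p []      = refl
reflect-walk C p (a ∷ w) = cong (reflect C p ∷_)
  (trans (reflect-walk C (move a p) w) (cong (λ q → walk q (opposite w)) (reflect-move C a p)))

reflect-endpt : ∀ C p w → reflect C (endpt p w) ≡ endpt (reflect C p) (opposite w)
reflect-endpt C p []      = refl
reflect-endpt C p (a ∷ w) =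
  trans (reflect-endpt C (move a p) w) (cong (λ q → endpt q (opposite w)) (reflect-move C a p))

module AntipodalRealisation {V : Chain} (A : Antipodal V) (p : Point) where

  twiceCentre : Point
  twiceCentre = p ⊕ pos V p 4

  reflect-pos : ∀ n → reflect twiceCentre (pos V p n) ≡ pos V p (4 + n)
  reflect-pos zero    = reflect-⊕ p (pos V p 4)
  reflect-pos (suc n) = begin
    reflect twiceCentre (endpt (pos V p n) (get V (suc n)))
      ≡⟨ reflect-endpt twiceCentre (pos V p n) (get V (suc n)) ⟩
    endpt (reflect twiceCentre (pos V p n)) (opposite (get V (suc n)))
      ≡⟨ cong₂ endpt (reflect-pos n) (sym (get-antiperiodic A (suc n))) ⟩
    endpt (pos V p (4 + n)) (get V (4 + suc n))
      ∎

  reflect-pos-4+ : ∀ n → reflect twiceCentre (pos V p (4 + n)) ≡ pos V p n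
  reflect-pos-4+ n =
    trans (cong (reflect twiceCentre) (sym (reflect-pos n)))
          (reflect-involutive twiceCentre (pos V p n))

  reflect-pos-shift4 : ∀ k → reflect twiceCentre (pos V p (toℕ k)) ≡ pos V p (toℕ (shift4 k))
  reflect-pos-shift4 0F = reflect-pos 0
  reflect-pos-shift4 1F = reflect-pos 1
  reflect-pos-shift4 2F = reflect-pos 2
  reflect-pos-shift4 3F = reflect-pos 3
  reflect-pos-shift4 4F = reflect-pos-4+ 0
  reflect-pos-shift4 5F = reflect-pos-4+ 1
  reflect-pos-shift4 6F = reflect-pos-4+ 2
  reflect-pos-shift4 7F = reflect-pos-4+ 3

  reflect-piece : ∀ k → map (reflect twiceCentre) (piece V p k) ≡ piece V p (shift4 k)
  reflect-piece k = begin
    map (reflect twiceCentre) (walk (pos V p (toℕ k)) (V k))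
      ≡⟨ reflect-walk twiceCentre (pos V p (toℕ k)) (V k) ⟩
    walk (reflect twiceCentre (pos V p (toℕ k))) (opposite (V k))
      ≡⟨ cong₂ walk (reflect-pos-shift4 k) (sym (A k)) ⟩
    walk (pos V p (toℕ (shift4 k))) (V (shift4 k))
      ∎

lemma12 : (V : Chain) → Descendant V → (p : Point) →
    Σ Point (λ C → (k : Fin 8) → map (reflect C) (piece V p k) ≡ piece V p (shift4 k))
lemma12 V d p = twiceCentre , reflect-piece
  where open AntipodalRealisation (descendant-antipodal d) p
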